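{- Let $K$ be an algebraically closed field, $N\in K[t]$, and $D=t^{m_0}(t-a_1)^{m_1}\cdots(t-a_k)^{m_k}$ where $m_0,m_1,\dots,m_k$ are positive integers and $a_1,\dots,a_k\in K$ are distinct and nonzero. Then $$t^{m_0}\,\mathsf{Frac}\!\left(\frac{N}{D},t^{m_0}\right)=\lceil t^{m_0}\rceil\, N s_1\cdots s_k,\qquad\text{where } s_i=\sum_{j=0}^{m_0-1}(-1)^{m_i}\binom{m_i-1+j}{j}\frac{t^j}{a_i^{m_i+j}}.$$
   Context: For $N,D\in K[t]$ with $D=D_1D'$, $D_1,D'$ relatively prime, write uniquely $N/D=p+r_1/D_1+r'/D'$ with $p,r_1,r'\in K[t]$, $\deg r_1<\deg D_1$, $\deg r'<\deg D'$; then $\mathsf{Frac}(N/D,D_1):=r_1/D_1$. The map $\lceil t^m\rceil:K[[t]]\to K[t]$ is truncation: $\lceil t^m\rceil\sum_{n\ge0}a_nt^n=\sum_{n=0}^{m-1}a_nt^n$. -}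

module Defs where

open import Level using (_⊔_)
open import Algebra.Bundles using (CommutativeRing)
open import Data.Nat using (ℕ; zero; suc; _≤_; _<_; _∸_)
import Data.Nat as Nat
open import Data.Nat.Combinatorics using (_C_)
open import Data.Fin using (Fin)
import Data.Fin as Fin
open import Data.List using (List; []; _∷_; map; take; upTo; foldr)
open import Data.Product using (Σ; ∃; _×_)
open import Relation.Nullary using (¬_)

module Poly {c ℓ} (R : CommutativeRing c ℓ) where
  open CommutativeRing R

  -- Polynomials in K[t] as coefficient lists (constant term first);
  -- equality is coefficientwise, so trailing zeros are irrelevant.
  Pol : Set c
  Pol = List Carrier

  coeff : Pol → ℕ → Carrier
  coeff []      _       = 0#
  coeff (a ∷ p) zero    = a
  coeff (a ∷ p) (suc n) = coeff p n

  _≈ₚ_ : Pol → Pol → Set ℓ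
  p ≈ₚ q = ∀ n → coeff p n ≈ coeff q n

  _+ₚ_ : Pol → Pol → Pol
  []      +ₚ q       = q
  (a ∷ p) +ₚ []      = a ∷ p
  (a ∷ p) +ₚ (b ∷ q) = (a + b) ∷ (p +ₚ q)

  scaleₚ : Carrier → Pol → Pol
  scaleₚ c p = map (c *_) p

  _*ₚ_ : Pol → Pol → Pol
  []      *ₚ q = []
  (a ∷ p) *ₚ q = scaleₚ a q +ₚ (0# ∷ (p *ₚ q))

  constₚ : Carrier → Pol
  constₚ a = a ∷ []

  tₚ : Pol
  tₚ = 0# ∷ 1# ∷ []

  t-ₚ : Carrier → Pol
  t-ₚ a = (- a) ∷ 1# ∷ []

  _^ₚ_ : Pol → ℕ → Pol
  p ^ₚ zero  = constₚ 1#
  p ^ₚ suc n = p *ₚ (p ^ₚ n)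

  prodFinₚ : (k : ℕ) → (Fin k → Pol) → Pol
  prodFinₚ zero    f = constₚ 1#
  prodFinₚ (suc k) f = f Fin.zero *ₚ prodFinₚ k (λ i → f (Fin.suc i))

  eval : Pol → Carrier → Carrier
  eval p x = foldr (λ a acc → a + x * acc) 0# p

  ⌈t^_⌉ : ℕ → Pol → Pol
  ⌈t^ m ⌉ p = take m p

  HasDegree : Pol → ℕ → Set ℓ
  HasDegree q d = (¬ (coeff q d ≈ 0#)) × (∀ n → d < n → coeff q n ≈ 0#)

  DegLt : Pol → Pol → Set ℓ
  DegLt r q = ∃ λ d → HasDegree q d × (∀ n → d ≤ n → coeff r n ≈ 0#)

  -- N/D = p + r₁/D₁ + r'/D'  with D = D₁ D', cleared of denominators
  -- and with the degree conditions deg r₁ < deg D₁, deg r' < deg D'.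
  IsPFD : (N D₁ D' p r₁ r' : Pol) → Set ℓ
  IsPFD N D₁ D' p r₁ r' =
    (N ≈ₚ ((p *ₚ (D₁ *ₚ D')) +ₚ ((r₁ *ₚ D') +ₚ (r' *ₚ D₁))))
    × DegLt r₁ D₁ × DegLt r' D'

  natK : ℕ → Carrier
  natK zero    = 0#
  natK (suc n) = 1# + natK n

  _^K_ : Carrier → ℕ → Carrier
  x ^K zero  = 1#
  x ^K suc n = x * (x ^K n)

  sₚ : (m₀ m : ℕ) (ainv : Carrier) → Pol
  sₚ m₀ m ainv =
    map (λ j → ((- 1#) ^K m) * (natK ((m ∸ 1 Nat.+ j) C j) * (ainv ^K (m Nat.+ j))))
        (upTo m₀)

record IsField {c ℓ} (R : CommutativeRing c ℓ) : Set (c ⊔ ℓ) where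
  open CommutativeRing R
  field
    1≉0 : ¬ (1# ≈ 0#)
    inverse : ∀ x → ¬ (x ≈ 0#) → ∃ λ y → x * y ≈ 1#

IsAlgClosed : ∀ {c ℓ} (R : CommutativeRing c ℓ) → Set (c ⊔ ℓ)
IsAlgClosed R = ∀ p d → HasDegree p (suc d) → ∃ λ x → eval p x ≈ 0#
  where open CommutativeRing R
        open Poly R

-- Modulo t^m₀ the factor D′ = ∏ᵢ (t - aᵢ)^mᵢ is invertible, with inverse S = s₁ ⋯ s_k: sᵢ is the
-- truncated expansion of (t - aᵢ)^(-mᵢ) at 0, and (t - a) s_{m+1} ≡ s_m (mod t^m₀) is Pascal's rule
-- for its binomial coefficients. Reducing N = p D₁ D′ + r₁ D′ + r′ D₁ modulo D₁ = t^m₀ gives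
-- r₁ ≡ N S, and deg r₁ < m₀ forces r₁ = ⌈t^m₀⌉ (N S). Conversely, for T = ⌈t^m₀⌉ (N S) the
-- polynomial N - T D′ is divisible by t^m₀, and dividing the cofactor by the monic D′ yields p and r′.

{-# OPTIONS --safe #-}
module Submission where

open import Algebra.Bundles using (AbelianGroup; CommutativeRing)
import Algebra.Properties.AbelianGroup as AbelianGroupProperties
import Algebra.Properties.CommutativeSemigroup as CommutativeSemigroupProperties
import Algebra.Properties.Ring as RingProperties
open import Data.Empty using (⊥-elim)
open import Data.Fin using (Fin)
import Data.Fin as Fin
open import Data.List using ([]; _∷_; map; applyUpTo; drop)
open import Data.Nat as ℕ using (ℕ; zero; suc; _≤_; _<_; z≤n; s≤s)
open import Data.Nat.Combinatorics using (_C_; nCn≡1; nCk+nC[k+1]≡[n+1]C[k+1])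
open import Data.Nat.Properties using (≤-trans; ≤-<-trans; <⇒≤; ≮⇒≥; m≤n+m; m≤n⇒m<n∨m≡n; <-cmp; +-suc)
open import Data.Product using (∃; ∃₂; _×_; _,_; proj₂)
open import Data.Sum using (_⊎_; inj₁; inj₂)
open import Function using (id)
open import Level using (_⊔_)
open import Relation.Binary.Bundles using (Setoid)
open import Relation.Binary.Definitions using (tri<; tri≈; tri>)
open import Relation.Binary.PropositionalEquality as ≡ using (_≡_)
import Relation.Binary.Reasoning.Setoid as SetoidReasoning
open import Relation.Binary.Structures using (IsEquivalence)
open import Relation.Nullary using (¬_; yes; no)

open import Defs

module PolynomialRing {c ℓ} (R : CommutativeRing c ℓ) where
  open CommutativeRing R hiding (zero)
  open RingProperties ring using (-1*x≈-x)
  open Poly R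

  coeff-+ₚ : ∀ p q n → coeff (p +ₚ q) n ≈ coeff p n + coeff q n
  coeff-+ₚ []      q       n       = sym (+-identityˡ _)
  coeff-+ₚ (a ∷ p) []      n       = sym (+-identityʳ _)
  coeff-+ₚ (a ∷ p) (b ∷ q) zero    = refl
  coeff-+ₚ (a ∷ p) (b ∷ q) (suc n) = coeff-+ₚ p q n

  coeff-scaleₚ : ∀ a p n → coeff (scaleₚ a p) n ≈ a * coeff p n
  coeff-scaleₚ a []      n       = sym (zeroʳ a)
  coeff-scaleₚ a (b ∷ p) zero    = refl
  coeff-scaleₚ a (b ∷ p) (suc n) = coeff-scaleₚ a p n

  coeff-∷-*ₚ : ∀ a p q n → coeff ((a ∷ p) *ₚ q) n ≈ a * coeff q n + coeff (0# ∷ (p *ₚ q)) n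
  coeff-∷-*ₚ a p q n = trans (coeff-+ₚ (scaleₚ a q) _ n) (+-congʳ (coeff-scaleₚ a q n))

  -- _≈ₚ_ wrapped in a record, so that both polynomials can be inferred from an equation.
  infix 4 _≋_
  record _≋_ (p q : Pol) : Set ℓ where
    constructor coeffwise
    field ≋⇒≈ₚ : p ≈ₚ q
  open _≋_ public

  ≋-isEquivalence : IsEquivalence _≋_
  ≋-isEquivalence = record
    { refl  = coeffwise λ _ → refl
    ; sym   = λ (coeffwise p≈q) → coeffwise λ n → sym (p≈q n)
    ; trans = λ (coeffwise p≈q) (coeffwise q≈r) → coeffwise λ n → trans (p≈q n) (q≈r n)
    }
  open IsEquivalence ≋-isEquivalence public
    using () renaming (refl to ≋-refl; sym to ≋-sym; trans to ≋-trans)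

  1ₚ : Pol
  1ₚ = constₚ 1#

  -ₚ_ : Pol → Pol
  -ₚ p = scaleₚ (- 1#) p

  ∷-cong : ∀ {a b p q} → a ≈ b → p ≋ q → a ∷ p ≋ b ∷ q
  ∷-cong a≈b (coeffwise p≈q) = coeffwise λ { zero → a≈b ; (suc n) → p≈q n }

  +ₚ-cong : ∀ {p p′ q q′} → p ≋ p′ → q ≋ q′ → p +ₚ q ≋ p′ +ₚ q′
  +ₚ-cong {p} {p′} {q} {q′} (coeffwise p≈p′) (coeffwise q≈q′) = coeffwise λ n →
    trans (coeff-+ₚ p q n) (trans (+-cong (p≈p′ n) (q≈q′ n)) (sym (coeff-+ₚ p′ q′ n)))

  +ₚ-congˡ : ∀ p {q q′} → q ≋ q′ → p +ₚ q ≋ p +ₚ q′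
  +ₚ-congˡ p = +ₚ-cong ≋-refl

  +ₚ-congʳ : ∀ q {p p′} → p ≋ p′ → p +ₚ q ≋ p′ +ₚ q
  +ₚ-congʳ q p≋p′ = +ₚ-cong p≋p′ ≋-refl

  +ₚ-comm : ∀ p q → p +ₚ q ≋ q +ₚ p
  +ₚ-comm p q = coeffwise λ n → trans (coeff-+ₚ p q n) (trans (+-comm _ _) (sym (coeff-+ₚ q p n)))

  +ₚ-assoc : ∀ p q r → (p +ₚ q) +ₚ r ≋ p +ₚ (q +ₚ r)
  +ₚ-assoc p q r = coeffwise λ n →
    trans (coeff-+ₚ (p +ₚ q) r n) (trans (+-congʳ (coeff-+ₚ p q n)) (trans (+-assoc _ _ _)
      (sym (trans (coeff-+ₚ p (q +ₚ r) n) (+-congˡ (coeff-+ₚ q r n))))))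

  +ₚ-identityˡ : ∀ p → [] +ₚ p ≋ p
  +ₚ-identityˡ p = ≋-refl

  +ₚ-identityʳ : ∀ p → p +ₚ [] ≋ p
  +ₚ-identityʳ p = coeffwise λ n → trans (coeff-+ₚ p [] n) (+-identityʳ _)

  -ₚ-cong : ∀ {p q} → p ≋ q → -ₚ p ≋ -ₚ q
  -ₚ-cong {p} {q} (coeffwise p≈q) = coeffwise λ n →
    trans (coeff-scaleₚ _ p n) (trans (*-congˡ (p≈q n)) (sym (coeff-scaleₚ _ q n)))

  -ₚ-inverseˡ : ∀ p → (-ₚ p) +ₚ p ≋ []
  -ₚ-inverseˡ p = coeffwise λ n → trans (coeff-+ₚ (-ₚ p) p n)
    (trans (+-congʳ (trans (coeff-scaleₚ _ p n) (-1*x≈-x _))) (-‿inverseˡ _))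

  -ₚ-inverseʳ : ∀ p → p +ₚ (-ₚ p) ≋ []
  -ₚ-inverseʳ p = ≋-trans (+ₚ-comm p (-ₚ p)) (-ₚ-inverseˡ p)

  +ₚ-abelianGroup : AbelianGroup c ℓ
  +ₚ-abelianGroup = record
    { Carrier = Pol ; _≈_ = _≋_ ; _∙_ = _+ₚ_ ; ε = [] ; _⁻¹ = -ₚ_
    ; isAbelianGroup = record
      { isGroup = record
        { isMonoid = record
          { isSemigroup = record
            { isMagma = record { isEquivalence = ≋-isEquivalence ; ∙-cong = +ₚ-cong }
            ; assoc = +ₚ-assoc }
          ; identity = +ₚ-identityˡ , +ₚ-identityʳ }
        ; inverse = -ₚ-inverseˡ , -ₚ-inverseʳ
        ; ⁻¹-cong = -ₚ-cong }
      ; comm = +ₚ-comm } }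

  open CommutativeSemigroupProperties (AbelianGroup.commutativeSemigroup +ₚ-abelianGroup) public
    using () renaming (interchange to +ₚ-interchange; x∙yz≈y∙xz to +ₚ-swap)

  scaleₚ-distribʳ : ∀ a b q → scaleₚ (a + b) q ≋ scaleₚ a q +ₚ scaleₚ b q
  scaleₚ-distribʳ a b q = coeffwise λ n → trans (coeff-scaleₚ _ q n) (trans (distribʳ _ a b)
    (sym (trans (coeff-+ₚ (scaleₚ a q) _ n) (+-cong (coeff-scaleₚ a q n) (coeff-scaleₚ b q n)))))

  scaleₚ-distribˡ : ∀ a p q → scaleₚ a (p +ₚ q) ≋ scaleₚ a p +ₚ scaleₚ a q
  scaleₚ-distribˡ a p q = coeffwise λ n → trans (coeff-scaleₚ a (p +ₚ q) n)
    (trans (*-congˡ (coeff-+ₚ p q n)) (trans (distribˡ a _ _)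
      (sym (trans (coeff-+ₚ (scaleₚ a p) _ n) (+-cong (coeff-scaleₚ a p n) (coeff-scaleₚ a q n))))))

  scaleₚ-scaleₚ : ∀ a b q → scaleₚ a (scaleₚ b q) ≋ scaleₚ (a * b) q
  scaleₚ-scaleₚ a b q = coeffwise λ n → trans (coeff-scaleₚ a (scaleₚ b q) n)
    (trans (*-congˡ (coeff-scaleₚ b q n)) (trans (sym (*-assoc _ _ _)) (sym (coeff-scaleₚ _ q n))))

  scaleₚ-zero : ∀ p → scaleₚ 0# p ≋ []
  scaleₚ-zero p = coeffwise λ n → trans (coeff-scaleₚ 0# p n) (zeroˡ _)

  scaleₚ-negate : ∀ a p → scaleₚ a p +ₚ scaleₚ (- a) p ≋ []
  scaleₚ-negate a p = ≋-trans (≋-sym (scaleₚ-distribʳ a (- a) p))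
    (coeffwise λ n → trans (coeff-scaleₚ _ p n) (trans (*-congʳ (-‿inverseʳ a)) (zeroˡ _)))

  coeff-*ₚ-vanishes : ∀ n p q → (∀ i → i ≤ n → coeff p i ≈ 0#) → coeff (p *ₚ q) n ≈ 0#
  coeff-*ₚ-vanishes n       []      q p≈0 = refl
  coeff-*ₚ-vanishes zero    (a ∷ p) q p≈0 = trans (coeff-∷-*ₚ a p q zero)
    (trans (+-congʳ (trans (*-congʳ (p≈0 0 z≤n)) (zeroˡ _))) (+-identityʳ _))
  coeff-*ₚ-vanishes (suc n) (a ∷ p) q p≈0 = trans (coeff-∷-*ₚ a p q (suc n))
    (trans (+-cong (trans (*-congʳ (p≈0 0 z≤n)) (zeroˡ _))
                   (coeff-*ₚ-vanishes n p q λ i i≤n → p≈0 (suc i) (s≤s i≤n)))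
      (+-identityʳ _))

  coeff-*ₚ-local : ∀ n p p′ q → (∀ i → i ≤ n → coeff p i ≈ coeff p′ i) →
                   coeff (p *ₚ q) n ≈ coeff (p′ *ₚ q) n
  coeff-*ₚ-local n       []      []       q p≈p′ = refl
  coeff-*ₚ-local n       []      (b ∷ p′) q p≈p′ =
    sym (coeff-*ₚ-vanishes n (b ∷ p′) q λ i i≤n → sym (p≈p′ i i≤n))
  coeff-*ₚ-local n       (a ∷ p) []       q p≈p′ = coeff-*ₚ-vanishes n (a ∷ p) q p≈p′
  coeff-*ₚ-local zero    (a ∷ p) (b ∷ p′) q p≈p′ = trans (coeff-∷-*ₚ a p q zero)
    (trans (+-congʳ (*-congʳ (p≈p′ 0 z≤n))) (sym (coeff-∷-*ₚ b p′ q zero)))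
  coeff-*ₚ-local (suc n) (a ∷ p) (b ∷ p′) q p≈p′ = trans (coeff-∷-*ₚ a p q (suc n))
    (trans (+-cong (*-congʳ (p≈p′ 0 z≤n)) (coeff-*ₚ-local n p p′ q λ i i≤n → p≈p′ (suc i) (s≤s i≤n)))
      (sym (coeff-∷-*ₚ b p′ q (suc n))))

  *ₚ-congʳ : ∀ q {p p′} → p ≋ p′ → p *ₚ q ≋ p′ *ₚ q
  *ₚ-congʳ q {p} {p′} (coeffwise p≈p′) = coeffwise λ n → coeff-*ₚ-local n p p′ q λ i _ → p≈p′ i

  *ₚ-zeroʳ : ∀ p → p *ₚ [] ≋ []
  *ₚ-zeroʳ []      = ≋-refl
  *ₚ-zeroʳ (a ∷ p) = coeffwise λ { zero → refl ; (suc n) → ≋⇒≈ₚ (*ₚ-zeroʳ p) n }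

  *ₚ-∷ʳ : ∀ q a p → q *ₚ (a ∷ p) ≋ scaleₚ a q +ₚ (0# ∷ (q *ₚ p))
  *ₚ-∷ʳ []      a p = coeffwise λ { zero → refl ; (suc n) → refl }
  *ₚ-∷ʳ (b ∷ q) a p = ∷-cong (+-congʳ (*-comm b a))
    (≋-trans (+ₚ-cong ≋-refl (*ₚ-∷ʳ q a p)) (+ₚ-swap (scaleₚ b p) (scaleₚ a q) _))

  *ₚ-comm : ∀ p q → p *ₚ q ≋ q *ₚ p
  *ₚ-comm []      q = ≋-sym (*ₚ-zeroʳ q)
  *ₚ-comm (a ∷ p) q = ≋-trans (+ₚ-cong ≋-refl (∷-cong refl (*ₚ-comm p q))) (≋-sym (*ₚ-∷ʳ q a p))

  *ₚ-congˡ : ∀ p {q q′} → q ≋ q′ → p *ₚ q ≋ p *ₚ q′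
  *ₚ-congˡ p {q} {q′} q≋q′ = ≋-trans (*ₚ-comm p q) (≋-trans (*ₚ-congʳ p q≋q′) (*ₚ-comm q′ p))

  *ₚ-cong : ∀ {p p′ q q′} → p ≋ p′ → q ≋ q′ → p *ₚ q ≋ p′ *ₚ q′
  *ₚ-cong {p} {p′} {q} p≋p′ q≋q′ = ≋-trans (*ₚ-congʳ q p≋p′) (*ₚ-congˡ p′ q≋q′)

  *ₚ-identityˡ : ∀ q → 1ₚ *ₚ q ≋ q
  *ₚ-identityˡ q = coeffwise λ n →
    trans (coeff-∷-*ₚ 1# [] q n) (trans (+-cong (*-identityˡ _) (coeff-0∷[] n)) (+-identityʳ _))
    where
    coeff-0∷[] : ∀ n → coeff (0# ∷ []) n ≈ 0#
    coeff-0∷[] zero    = refl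
    coeff-0∷[] (suc n) = refl

  *ₚ-identityʳ : ∀ q → q *ₚ 1ₚ ≋ q
  *ₚ-identityʳ q = ≋-trans (*ₚ-comm q 1ₚ) (*ₚ-identityˡ q)

  *ₚ-distribʳ : ∀ q p p′ → (p +ₚ p′) *ₚ q ≋ (p *ₚ q) +ₚ (p′ *ₚ q)
  *ₚ-distribʳ q []      p′       = ≋-refl
  *ₚ-distribʳ q (a ∷ p) []       = ≋-sym (+ₚ-identityʳ _)
  *ₚ-distribʳ q (a ∷ p) (b ∷ p′) = ≋-trans
    (+ₚ-cong (scaleₚ-distribʳ a b q) (∷-cong (sym (+-identityˡ 0#)) (*ₚ-distribʳ q p p′)))
    (+ₚ-interchange (scaleₚ a q) (scaleₚ b q) (0# ∷ (p *ₚ q)) (0# ∷ (p′ *ₚ q)))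

  *ₚ-distribˡ : ∀ q p p′ → q *ₚ (p +ₚ p′) ≋ (q *ₚ p) +ₚ (q *ₚ p′)
  *ₚ-distribˡ q p p′ = ≋-trans (*ₚ-comm q _)
    (≋-trans (*ₚ-distribʳ q p p′) (+ₚ-cong (*ₚ-comm p q) (*ₚ-comm p′ q)))

  scaleₚ-*ₚ : ∀ a q r → scaleₚ a q *ₚ r ≋ scaleₚ a (q *ₚ r)
  scaleₚ-*ₚ a []      r = ≋-refl
  scaleₚ-*ₚ a (b ∷ q) r = ≋-trans
    (+ₚ-cong (≋-sym (scaleₚ-scaleₚ a b r)) (∷-cong (sym (zeroʳ a)) (scaleₚ-*ₚ a q r)))
    (≋-sym (scaleₚ-distribˡ a (scaleₚ b r) (0# ∷ (q *ₚ r))))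

  0∷-*ₚ : ∀ q r → (0# ∷ q) *ₚ r ≋ 0# ∷ (q *ₚ r)
  0∷-*ₚ q r = +ₚ-cong (scaleₚ-zero r) ≋-refl

  *ₚ-assoc : ∀ p q r → (p *ₚ q) *ₚ r ≋ p *ₚ (q *ₚ r)
  *ₚ-assoc []      q r = ≋-refl
  *ₚ-assoc (a ∷ p) q r = ≋-trans (*ₚ-distribʳ r (scaleₚ a q) (0# ∷ (p *ₚ q)))
    (+ₚ-cong (scaleₚ-*ₚ a q r) (≋-trans (0∷-*ₚ (p *ₚ q) r) (∷-cong refl (*ₚ-assoc p q r))))

  polyRing : CommutativeRing c ℓ
  polyRing = record
    { Carrier = Pol ; _≈_ = _≋_ ; _+_ = _+ₚ_ ; _*_ = _*ₚ_ ; -_ = -ₚ_ ; 0# = [] ; 1# = 1ₚ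
    ; isCommutativeRing = record
      { isRing = record
        { +-isAbelianGroup = AbelianGroup.isAbelianGroup +ₚ-abelianGroup
        ; *-cong = *ₚ-cong
        ; *-assoc = *ₚ-assoc
        ; *-identity = *ₚ-identityˡ , *ₚ-identityʳ
        ; distrib = *ₚ-distribˡ , *ₚ-distribʳ }
      ; *-comm = *ₚ-comm } }

  module ≋-Reasoning = SetoidReasoning (CommutativeRing.setoid polyRing)

module Truncation {c ℓ} (R : CommutativeRing c ℓ) where
  open CommutativeRing R hiding (zero)
  open Poly R
  open PolynomialRing R

  infix 4 _≈[mod-t^_]_
  record _≈[mod-t^_]_ (p : Pol) (m : ℕ) (q : Pol) : Set ℓ where
    constructor coeffwise<
    field ≈[mod-t^]⇒≈ : ∀ n → n < m → coeff p n ≈ coeff q n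
  open _≈[mod-t^_]_ public

  ≈mod-setoid : ℕ → Setoid c ℓ
  ≈mod-setoid m = record
    { Carrier = Pol
    ; _≈_ = _≈[mod-t^ m ]_
    ; isEquivalence = record
      { refl  = coeffwise< λ _ _ → refl
      ; sym   = λ (coeffwise< p≈q) → coeffwise< λ n n<m → sym (p≈q n n<m)
      ; trans = λ (coeffwise< p≈q) (coeffwise< q≈r) → coeffwise< λ n n<m → trans (p≈q n n<m) (q≈r n n<m)
      }
    }

  module ≈mod-Reasoning (m : ℕ) = SetoidReasoning (≈mod-setoid m)

  ≋⇒≈mod : ∀ {m p q} → p ≋ q → p ≈[mod-t^ m ] q
  ≋⇒≈mod (coeffwise p≈q) = coeffwise< λ n _ → p≈q n

  +ₚ-cong-mod : ∀ {m p p′ q q′} → p ≈[mod-t^ m ] p′ → q ≈[mod-t^ m ] q′ → p +ₚ q ≈[mod-t^ m ] p′ +ₚ q′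
  +ₚ-cong-mod {p = p} {p′} {q} {q′} (coeffwise< p≈p′) (coeffwise< q≈q′) = coeffwise< λ n n<m →
    trans (coeff-+ₚ p q n) (trans (+-cong (p≈p′ n n<m) (q≈q′ n n<m)) (sym (coeff-+ₚ p′ q′ n)))

  +ₚ-congˡ-mod : ∀ {m q q′} p → q ≈[mod-t^ m ] q′ → p +ₚ q ≈[mod-t^ m ] p +ₚ q′
  +ₚ-congˡ-mod p = +ₚ-cong-mod (≋⇒≈mod ≋-refl)

  -ₚ-cong-mod : ∀ {m p q} → p ≈[mod-t^ m ] q → -ₚ p ≈[mod-t^ m ] -ₚ q
  -ₚ-cong-mod {p = p} {q} (coeffwise< p≈q) = coeffwise< λ n n<m →
    trans (coeff-scaleₚ _ p n) (trans (*-congˡ (p≈q n n<m)) (sym (coeff-scaleₚ _ q n)))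

  *ₚ-congʳ-mod : ∀ {m p p′} q → p ≈[mod-t^ m ] p′ → p *ₚ q ≈[mod-t^ m ] p′ *ₚ q
  *ₚ-congʳ-mod {p = p} {p′} q (coeffwise< p≈p′) = coeffwise< λ n n<m →
    coeff-*ₚ-local n p p′ q λ i i≤n → p≈p′ i (≤-<-trans i≤n n<m)

  *ₚ-congˡ-mod : ∀ {m q q′} p → q ≈[mod-t^ m ] q′ → p *ₚ q ≈[mod-t^ m ] p *ₚ q′
  *ₚ-congˡ-mod {m} {q} {q′} p q≈q′ = begin
    p *ₚ q   ≈⟨ ≋⇒≈mod (*ₚ-comm p q) ⟩
    q *ₚ p   ≈⟨ *ₚ-congʳ-mod p q≈q′ ⟩
    q′ *ₚ p  ≈⟨ ≋⇒≈mod (*ₚ-comm q′ p) ⟩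
    p *ₚ q′  ∎
    where open ≈mod-Reasoning m

  *ₚ-cong-mod : ∀ {m p p′ q q′} → p ≈[mod-t^ m ] p′ → q ≈[mod-t^ m ] q′ → p *ₚ q ≈[mod-t^ m ] p′ *ₚ q′
  *ₚ-cong-mod {m} {p} {p′} {q} {q′} p≈p′ q≈q′ = begin
    p *ₚ q   ≈⟨ *ₚ-congʳ-mod q p≈p′ ⟩
    p′ *ₚ q  ≈⟨ *ₚ-congˡ-mod p′ q≈q′ ⟩
    p′ *ₚ q′ ∎
    where open ≈mod-Reasoning m

  open CommutativeSemigroupProperties (CommutativeRing.*-commutativeSemigroup polyRing)
    using () renaming (interchange to *ₚ-interchange)

  prodFinₚ-inverse : ∀ {m} k (f g : Fin k → Pol) → (∀ i → f i *ₚ g i ≈[mod-t^ m ] 1ₚ) →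
                     prodFinₚ k f *ₚ prodFinₚ k g ≈[mod-t^ m ] 1ₚ
  prodFinₚ-inverse zero    f g fg≈1 = ≋⇒≈mod (*ₚ-identityˡ 1ₚ)
  prodFinₚ-inverse {m} (suc k) f g fg≈1 = begin
    (f Fin.zero *ₚ F) *ₚ (g Fin.zero *ₚ G) ≈⟨ ≋⇒≈mod (*ₚ-interchange (f Fin.zero) F (g Fin.zero) G) ⟩
    (f Fin.zero *ₚ g Fin.zero) *ₚ (F *ₚ G) ≈⟨ *ₚ-cong-mod (fg≈1 Fin.zero)
                                                (prodFinₚ-inverse k _ _ λ i → fg≈1 (Fin.suc i)) ⟩
    1ₚ *ₚ 1ₚ                               ≈⟨ ≋⇒≈mod (*ₚ-identityˡ 1ₚ) ⟩
    1ₚ                                     ∎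
    where
    open ≈mod-Reasoning m
    F G : Pol
    F = prodFinₚ k (λ i → f (Fin.suc i))
    G = prodFinₚ k (λ i → g (Fin.suc i))

  DegreeBelow : ℕ → Pol → Set ℓ
  DegreeBelow d p = ∀ n → d ≤ n → coeff p n ≈ 0#

  ≈mod⇒≈ₚ : ∀ {m p q} → DegreeBelow m p → DegreeBelow m q → p ≈[mod-t^ m ] q → p ≈ₚ q
  ≈mod⇒≈ₚ {m} p<m q<m (coeffwise< p≈q) n with n ℕ.<? m
  ... | yes n<m = p≈q n n<m
  ... | no  n≮m = trans (p<m n (≮⇒≥ n≮m)) (sym (q<m n (≮⇒≥ n≮m)))

  coeff-⌈t^⌉-< : ∀ m p n → n < m → coeff (⌈t^ m ⌉ p) n ≡ coeff p n
  coeff-⌈t^⌉-< (suc m) []      n       _         = ≡.refl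
  coeff-⌈t^⌉-< (suc m) (a ∷ p) zero    _         = ≡.refl
  coeff-⌈t^⌉-< (suc m) (a ∷ p) (suc n) (s≤s n<m) = coeff-⌈t^⌉-< m p n n<m

  coeff-⌈t^⌉-≥ : ∀ m p n → m ≤ n → coeff (⌈t^ m ⌉ p) n ≡ 0#
  coeff-⌈t^⌉-≥ zero    p       n       _         = ≡.refl
  coeff-⌈t^⌉-≥ (suc m) []      n       _         = ≡.refl
  coeff-⌈t^⌉-≥ (suc m) (a ∷ p) (suc n) (s≤s m≤n) = coeff-⌈t^⌉-≥ m p n m≤n

  ⌈t^⌉-≈mod : ∀ m p → ⌈t^ m ⌉ p ≈[mod-t^ m ] p
  ⌈t^⌉-≈mod m p = coeffwise< λ n n<m → reflexive (coeff-⌈t^⌉-< m p n n<m)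

  ⌈t^⌉-degreeBelow : ∀ m p → DegreeBelow m (⌈t^ m ⌉ p)
  ⌈t^⌉-degreeBelow m p n m≤n = reflexive (coeff-⌈t^⌉-≥ m p n m≤n)

  tₚ-*ₚ : ∀ p → tₚ *ₚ p ≋ 0# ∷ p
  tₚ-*ₚ p = +ₚ-cong (scaleₚ-zero p) (∷-cong refl (*ₚ-identityˡ p))

  tₚ^≈0 : ∀ m → tₚ ^ₚ m ≈[mod-t^ m ] []
  tₚ^≈0 zero    = coeffwise< λ _ ()
  tₚ^≈0 (suc m) = coeffwise< λ
    { zero    _         → ≋⇒≈ₚ (tₚ-*ₚ (tₚ ^ₚ m)) zero
    ; (suc n) (s≤s n<m) → trans (≋⇒≈ₚ (tₚ-*ₚ (tₚ ^ₚ m)) (suc n)) (≈[mod-t^]⇒≈ (tₚ^≈0 m) n n<m) }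

  ≈0⇒tₚ^-factor : ∀ m p → p ≈[mod-t^ m ] [] → p ≋ (tₚ ^ₚ m) *ₚ drop m p
  ≈0⇒tₚ^-factor zero    p       _  = ≋-sym (*ₚ-identityˡ p)
  ≈0⇒tₚ^-factor (suc m) []      _  = ≋-sym (*ₚ-zeroʳ (tₚ ^ₚ suc m))
  ≈0⇒tₚ^-factor (suc m) (a ∷ p) (coeffwise< p≈0) = ≋-trans
    (∷-cong (p≈0 zero (s≤s z≤n)) (≈0⇒tₚ^-factor m p (coeffwise< λ n n<m → p≈0 (suc n) (s≤s n<m))))
    (≋-sym (≋-trans (*ₚ-assoc tₚ (tₚ ^ₚ m) (drop m p)) (tₚ-*ₚ _)))

module MonicDivision {c ℓ} (R : CommutativeRing c ℓ) where
  open CommutativeRing R hiding (zero)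
  open Poly R
  open PolynomialRing R
  open Truncation R

  record Monic (d : ℕ) (p : Pol) : Set ℓ where
    constructor monic
    field
      leading : coeff p d ≈ 1#
      degree< : DegreeBelow (suc d) p
  open Monic public

  degreeBelow-*ₚ : ∀ b e p q → DegreeBelow b p → DegreeBelow (suc e) q → DegreeBelow (b ℕ.+ e) (p *ₚ q)
  degreeBelow-*ₚ b       e []      q p<b q<e+1 n       _   = refl
  degreeBelow-*ₚ zero    e (a ∷ p) q p<b q<e+1 n       _   =
    coeff-*ₚ-vanishes n (a ∷ p) q λ i _ → p<b i z≤n
  degreeBelow-*ₚ (suc b) e (a ∷ p) q p<b q<e+1 (suc n) (s≤s b+e≤n) = trans (coeff-∷-*ₚ a p q (suc n))
    (trans (+-cong (trans (*-congˡ (q<e+1 (suc n) (s≤s (≤-trans (m≤n+m e b) b+e≤n)))) (zeroʳ a))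
                   (degreeBelow-*ₚ b e p q (λ i b≤i → p<b (suc i) (s≤s b≤i)) q<e+1 n b+e≤n))
      (+-identityʳ 0#))

  coeff-*ₚ-top : ∀ d e p q → DegreeBelow (suc d) p → DegreeBelow (suc e) q →
                 coeff (p *ₚ q) (d ℕ.+ e) ≈ coeff p d * coeff q e
  coeff-*ₚ-top d       e []      q p<d+1 q<e+1 = sym (zeroˡ _)
  coeff-*ₚ-top zero    e (a ∷ p) q p<d+1 q<e+1 = trans (coeff-∷-*ₚ a p q e)
    (trans (+-congˡ (coeff-0∷p*q e)) (+-identityʳ _))
    where
    coeff-0∷p*q : ∀ e → coeff (0# ∷ (p *ₚ q)) e ≈ 0#
    coeff-0∷p*q zero    = refl
    coeff-0∷p*q (suc e) = coeff-*ₚ-vanishes e p q λ i _ → p<d+1 (suc i) (s≤s z≤n)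
  coeff-*ₚ-top (suc d) e (a ∷ p) q p<d+1 q<e+1 = trans (coeff-∷-*ₚ a p q (suc (d ℕ.+ e)))
    (trans (+-cong (trans (*-congˡ (q<e+1 (suc (d ℕ.+ e)) (s≤s (m≤n+m e d)))) (zeroʳ a))
                   (coeff-*ₚ-top d e p q (λ i d<i → p<d+1 (suc i) (s≤s d<i)) q<e+1))
      (+-identityˡ _))

  monic-*ₚ : ∀ {d e p q} → Monic d p → Monic e q → Monic (d ℕ.+ e) (p *ₚ q)
  monic-*ₚ {d} {e} {p} {q} (monic p₁ p<d+1) (monic q₁ q<e+1) = monic
    (trans (coeff-*ₚ-top d e p q p<d+1 q<e+1) (trans (*-cong p₁ q₁) (*-identityˡ 1#)))
    (degreeBelow-*ₚ (suc d) e p q p<d+1 q<e+1)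

  1ₚ-monic : Monic 0 1ₚ
  1ₚ-monic = monic refl λ { (suc n) _ → refl }

  monic-^ₚ : ∀ {p} → Monic 1 p → ∀ m → Monic m (p ^ₚ m)
  monic-^ₚ p-monic zero    = 1ₚ-monic
  monic-^ₚ p-monic (suc m) = monic-*ₚ p-monic (monic-^ₚ p-monic m)

  tₚ-monic : Monic 1 tₚ
  tₚ-monic = monic refl λ { (suc (suc n)) _ → refl ; (suc zero) (s≤s ()) }

  t-ₚ-monic : ∀ a → Monic 1 (t-ₚ a)
  t-ₚ-monic a = monic refl λ { (suc (suc n)) _ → refl ; (suc zero) (s≤s ()) }

  prodFinₚ-monic : ∀ k (f : Fin k → Pol) → (∀ i → ∃ λ d → Monic d (f i)) → ∃ λ d → Monic d (prodFinₚ k f)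
  prodFinₚ-monic zero    f _       = 0 , 1ₚ-monic
  prodFinₚ-monic (suc k) f f-monic
    with f-monic Fin.zero | prodFinₚ-monic k (λ i → f (Fin.suc i)) (λ i → f-monic (Fin.suc i))
  ... | d , f₀-monic | e , fₛ-monic = d ℕ.+ e , monic-*ₚ f₀-monic fₛ-monic

  monic⇒hasDegree : ¬ 1# ≈ 0# → ∀ {d p} → Monic d p → HasDegree p d
  monic⇒hasDegree 1≉0 (monic p₁ p<d+1) = (λ p₀ → 1≉0 (trans (sym p₁) p₀)) , p<d+1

  hasDegree-tₚ^ : ∀ {m d} → HasDegree (tₚ ^ₚ m) d → d ≡ m
  hasDegree-tₚ^ {m} {d} (t^m≉0 , _) with <-cmp d m
  ... | tri< d<m _ _ = ⊥-elim (t^m≉0 (≈[mod-t^]⇒≈ (tₚ^≈0 m) d d<m))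
  ... | tri≈ _ d≡m _ = d≡m
  ... | tri> _ _ m<d = ⊥-elim (t^m≉0 (degree< (monic-^ₚ tₚ-monic m) d m<d))

  record Division (Q D : Pol) (d : ℕ) : Set (c ⊔ ℓ) where
    constructor division
    field
      quotient remainder : Pol
      Q≋quotient*D+remainder : Q ≋ (quotient *ₚ D) +ₚ remainder
      remainder<d : DegreeBelow d remainder

  divMonic : ∀ {d D} → Monic d D → ∀ Q → Division Q D d
  divMonic {zero} {D} D-monic Q = division Q [] Q≋QD λ _ _ → refl
    where
    D≋1 : D ≋ 1ₚ
    D≋1 = coeffwise λ { zero → leading D-monic ; (suc n) → degree< D-monic (suc n) (s≤s z≤n) }
    Q≋QD : Q ≋ (Q *ₚ D) +ₚ []
    Q≋QD = ≋-sym (≋-trans (+ₚ-identityʳ _) (≋-trans (*ₚ-congˡ Q D≋1) (*ₚ-identityʳ Q)))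
  divMonic {suc d} D-monic []      = division [] [] ≋-refl λ _ _ → refl
  divMonic {suc d} {D} D-monic (a ∷ Q) with divMonic D-monic Q
  ... | division p r Q≋pD+r r<d+1 = division (top ∷ p) ((a ∷ r) +ₚ scaleₚ (- top) D) a∷Q≋ remainder<
    where
    -- a + t r has degree ≤ d + 1, with top as coefficient of t^(d+1); top D cancels it
    top : Carrier
    top = coeff r d

    a∷Q≋ : a ∷ Q ≋ ((top ∷ p) *ₚ D) +ₚ ((a ∷ r) +ₚ scaleₚ (- top) D)
    a∷Q≋ = begin
      a ∷ Q
        ≈⟨ ∷-cong (sym (+-identityˡ a)) Q≋pD+r ⟩
      (0# ∷ (p *ₚ D)) +ₚ (a ∷ r)
        ≈⟨ +ₚ-congʳ ((0# ∷ (p *ₚ D)) +ₚ (a ∷ r)) (≋-sym (scaleₚ-negate top D)) ⟩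
      (scaleₚ top D +ₚ scaleₚ (- top) D) +ₚ ((0# ∷ (p *ₚ D)) +ₚ (a ∷ r))
        ≈⟨ +ₚ-interchange (scaleₚ top D) (scaleₚ (- top) D) (0# ∷ (p *ₚ D)) (a ∷ r) ⟩
      (scaleₚ top D +ₚ (0# ∷ (p *ₚ D))) +ₚ (scaleₚ (- top) D +ₚ (a ∷ r))
        ≈⟨ +ₚ-congˡ ((top ∷ p) *ₚ D) (+ₚ-comm (scaleₚ (- top) D) (a ∷ r)) ⟩
      ((top ∷ p) *ₚ D) +ₚ ((a ∷ r) +ₚ scaleₚ (- top) D)
        ∎
      where open ≋-Reasoning

    remainder< : DegreeBelow (suc d) ((a ∷ r) +ₚ scaleₚ (- top) D)
    remainder< (suc n) (s≤s d≤n) = trans (coeff-+ₚ (a ∷ r) (scaleₚ (- top) D) (suc n))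
      (trans (+-congˡ (coeff-scaleₚ (- top) D (suc n))) (leading-cancels (m≤n⇒m<n∨m≡n d≤n)))
      where
      leading-cancels : d < n ⊎ d ≡ n → coeff r n + - top * coeff D (suc n) ≈ 0#
      leading-cancels (inj₁ d<n)  = trans (+-cong (r<d+1 n d<n)
        (trans (*-congˡ (degree< D-monic (suc n) (s≤s d<n))) (zeroʳ _))) (+-identityˡ 0#)
      leading-cancels (inj₂ ≡.refl) = trans (+-congˡ (trans (*-congˡ (leading D-monic)) (*-identityʳ _)))
        (-‿inverseʳ top)

module BinomialSeries {c ℓ} (R : CommutativeRing c ℓ) where
  open CommutativeRing R hiding (zero)
  open Poly R
  open PolynomialRing R
  open Truncation R
  open CommutativeSemigroupProperties *-commutativeSemigroup using (x∙yz≈y∙xz)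
  open CommutativeSemigroupProperties (CommutativeRing.*-commutativeSemigroup polyRing)
    using (xy∙z≈y∙xz)
  open RingProperties ring using (-1*x≈-x; -‿distribˡ-*; -‿distribʳ-*; -‿involutive)
  open AbelianGroupProperties +-abelianGroup using (xyx⁻¹≈y)

  [-1*x]*y≈-[x*y] : ∀ x y → (- 1# * x) * y ≈ - (x * y)
  [-1*x]*y≈-[x*y] x y = trans (*-congʳ (-1*x≈-x x)) (sym (-‿distribˡ-* x y))

  -x*-y≈x*y : ∀ x y → - x * - y ≈ x * y
  -x*-y≈x*y x y = trans (sym (-‿distribˡ-* x (- y))) (trans (-‿cong (sym (-‿distribʳ-* x y))) (-‿involutive _))

  natK-homo-+ : ∀ x y → natK (x ℕ.+ y) ≈ natK x + natK y
  natK-homo-+ zero    y = sym (+-identityˡ _)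
  natK-homo-+ (suc x) y = trans (+-congˡ (natK-homo-+ x y)) (sym (+-assoc _ _ _))

  natK-pascal : ∀ k j → natK (suc k C suc j) ≈ natK (k C j) + natK (k C suc j)
  natK-pascal k j = trans (reflexive (≡.cong natK (≡.sym (nCk+nC[k+1]≡[n+1]C[k+1] k j))))
    (natK-homo-+ (k C j) (k C suc j))

  linearTimes : Carrier → (ℕ → Carrier) → ℕ → Carrier
  linearTimes a f zero    = - a * f zero
  linearTimes a f (suc j) = - a * f (suc j) + f j

  coeff-t-ₚ-*ₚ : ∀ a p j → coeff (t-ₚ a *ₚ p) j ≈ linearTimes a (coeff p) j
  coeff-t-ₚ-*ₚ a p zero    = trans (coeff-∷-*ₚ (- a) 1ₚ p zero) (+-identityʳ _)
  coeff-t-ₚ-*ₚ a p (suc j) = trans (coeff-∷-*ₚ (- a) 1ₚ p (suc j)) (+-congˡ (≋⇒≈ₚ (*ₚ-identityˡ p) j))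

  coeff-map-applyUpTo : ∀ (f : ℕ → Carrier) g n j → j < n → coeff (map f (applyUpTo g n)) j ≡ f (g j)
  coeff-map-applyUpTo f g (suc n) zero    _         = ≡.refl
  coeff-map-applyUpTo f g (suc n) (suc j) (s≤s j<n) = coeff-map-applyUpTo f (λ i → g (suc i)) n j j<n

  module _ {a b : Carrier} (ab≈1 : a * b ≈ 1#) where

    -- Indexed by n = m - 1: at m = 0 the truncated subtraction in sₚ yields bʲ, not the coefficients of 1.
    s-coeff : ℕ → ℕ → Carrier
    s-coeff n j = (- 1#) ^K suc n * (natK ((n ℕ.+ j) C j) * b ^K suc (n ℕ.+ j))

    coeff-sₚ : ∀ m₀ n j → j < m₀ → coeff (sₚ m₀ (suc n) b) j ≡ s-coeff n j
    coeff-sₚ m₀ n = coeff-map-applyUpTo (s-coeff n) id m₀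

    cancel-a*b : ∀ σ Z B → - a * ((- 1# * σ) * (Z * (b * B))) ≈ σ * (Z * B)
    cancel-a*b σ Z B = begin
      - a * ((- 1# * σ) * (Z * (b * B)))   ≈⟨ *-congˡ ([-1*x]*y≈-[x*y] σ _) ⟩
      - a * - (σ * (Z * (b * B)))          ≈⟨ -x*-y≈x*y a _ ⟩
      a * (σ * (Z * (b * B)))              ≈⟨ *-congˡ (*-congˡ (x∙yz≈y∙xz Z b B)) ⟩
      a * (σ * (b * (Z * B)))              ≈⟨ *-congˡ (x∙yz≈y∙xz σ b _) ⟩
      a * (b * (σ * (Z * B)))              ≈⟨ *-assoc a b _ ⟨
      (a * b) * (σ * (Z * B))              ≈⟨ *-congʳ ab≈1 ⟩
      1# * (σ * (Z * B))                   ≈⟨ *-identityˡ _ ⟩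
      σ * (Z * B)                          ∎
      where open SetoidReasoning setoid

    linearTimes-s₁ : ∀ j → linearTimes a (s-coeff 0) j ≈ coeff 1ₚ j
    linearTimes-s₁ zero    = trans (cancel-a*b 1# _ 1#)
      (trans (*-identityˡ _) (trans (*-identityʳ _) (+-identityʳ 1#)))
    linearTimes-s₁ (suc j) = begin
      - a * s-coeff 0 (suc j) + s-coeff 0 j                                ≈⟨ +-congʳ (cancel-a*b 1# _ _) ⟩
      1# * (natK (suc j C suc j) * B) + (- 1# * 1#) * (natK (j C j) * B)  ≡⟨ ≡.cong (λ x → 1# * (natK x * B) + (- 1# * 1#) * (natK (j C j) * B)) (≡.trans (nCn≡1 (suc j)) (≡.sym (nCn≡1 j))) ⟩
      1# * (natK (j C j) * B) + (- 1# * 1#) * (natK (j C j) * B)          ≈⟨ +-congˡ ([-1*x]*y≈-[x*y] 1# _) ⟩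
      1# * (natK (j C j) * B) + - (1# * (natK (j C j) * B))               ≈⟨ -‿inverseʳ _ ⟩
      0#                                                                   ∎
      where
      open SetoidReasoning setoid
      B : Carrier
      B = b ^K suc j

    linearTimes-sₙ₊₂ : ∀ n j → linearTimes a (s-coeff (suc n)) j ≈ s-coeff n j
    linearTimes-sₙ₊₂ n zero    = cancel-a*b _ _ _
    linearTimes-sₙ₊₂ n (suc j) = begin
      - a * s-coeff (suc n) (suc j) + s-coeff (suc n) j
        ≈⟨ +-congʳ (cancel-a*b σ _ _) ⟩
      σ * (natK (suc k C suc j) * B) + (- 1# * σ) * (natK (suc (n ℕ.+ j) C j) * b ^K suc (suc (n ℕ.+ j)))
        ≡⟨ ≡.cong (λ i → σ * (natK (suc k C suc j) * B) + (- 1# * σ) * (natK (i C j) * b ^K suc i)) (≡.sym (+-suc n j)) ⟩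
      σ * (natK (suc k C suc j) * B) + (- 1# * σ) * (natK (k C j) * B)
        ≈⟨ +-cong (*-congˡ (*-congʳ (natK-pascal k j))) ([-1*x]*y≈-[x*y] σ _) ⟩
      σ * ((natK (k C j) + natK (k C suc j)) * B) + - (σ * (natK (k C j) * B))
        ≈⟨ +-congʳ (trans (*-congˡ (distribʳ B _ _)) (distribˡ σ _ _)) ⟩
      (σ * (natK (k C j) * B) + σ * (natK (k C suc j) * B)) + - (σ * (natK (k C j) * B))
        ≈⟨ xyx⁻¹≈y _ _ ⟩
      σ * (natK (k C suc j) * B)
        ∎
      where
      open SetoidReasoning setoid
      k : ℕ
      k = n ℕ.+ suc j
      σ B : Carrier
      σ = (- 1#) ^K suc n
      B = b ^K suc k

    t-ₚ-*ₚ-sₚ≈ : ∀ m₀ n q → (∀ j → j < m₀ → linearTimes a (s-coeff n) j ≈ coeff q j) →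
                t-ₚ a *ₚ sₚ m₀ (suc n) b ≈[mod-t^ m₀ ] q
    t-ₚ-*ₚ-sₚ≈ m₀ n q hyp = coeffwise< λ j j<m₀ →
      trans (coeff-t-ₚ-*ₚ a (sₚ m₀ (suc n) b) j) (trans (coeffs-agree j j<m₀) (hyp j j<m₀))
      where
      coeffs-agree : ∀ j → j < m₀ → linearTimes a (coeff (sₚ m₀ (suc n) b)) j ≈ linearTimes a (s-coeff n) j
      coeffs-agree zero    0<m₀   = *-congˡ (reflexive (coeff-sₚ m₀ n zero 0<m₀))
      coeffs-agree (suc j) j+1<m₀ = +-cong (*-congˡ (reflexive (coeff-sₚ m₀ n (suc j) j+1<m₀)))
                                           (reflexive (coeff-sₚ m₀ n j (<⇒≤ j+1<m₀)))

    [t-a]^m*sₘ≈1 : ∀ m₀ {m} → 1 ≤ m → (t-ₚ a ^ₚ m) *ₚ sₚ m₀ m b ≈[mod-t^ m₀ ] 1ₚ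
    [t-a]^m*sₘ≈1 m₀ {suc zero}    _ = begin
      (t-ₚ a *ₚ 1ₚ) *ₚ sₚ m₀ 1 b  ≈⟨ ≋⇒≈mod (*ₚ-congʳ (sₚ m₀ 1 b) (*ₚ-identityʳ (t-ₚ a))) ⟩
      t-ₚ a *ₚ sₚ m₀ 1 b          ≈⟨ t-ₚ-*ₚ-sₚ≈ m₀ 0 1ₚ (λ j _ → linearTimes-s₁ j) ⟩
      1ₚ                          ∎
      where open ≈mod-Reasoning m₀
    [t-a]^m*sₘ≈1 m₀ {suc (suc n)} _ = begin
      (t-ₚ a *ₚ P) *ₚ sₚ m₀ (suc (suc n)) b  ≈⟨ ≋⇒≈mod (xy∙z≈y∙xz (t-ₚ a) P _) ⟩
      P *ₚ (t-ₚ a *ₚ sₚ m₀ (suc (suc n)) b)  ≈⟨ *ₚ-congˡ-mod P (t-ₚ-*ₚ-sₚ≈ m₀ (suc n) _ sₙ₊₁-coeffs) ⟩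
      P *ₚ sₚ m₀ (suc n) b                    ≈⟨ [t-a]^m*sₘ≈1 m₀ {suc n} (s≤s z≤n) ⟩
      1ₚ                                      ∎
      where
      open ≈mod-Reasoning m₀
      P : Pol
      P = t-ₚ a ^ₚ suc n
      sₙ₊₁-coeffs : ∀ j → j < m₀ → linearTimes a (s-coeff (suc n)) j ≈ coeff (sₚ m₀ (suc n) b) j
      sₙ₊₁-coeffs j j<m₀ = trans (linearTimes-sₙ₊₂ n j) (reflexive (≡.sym (coeff-sₚ m₀ n j j<m₀)))

module PartialFractions {c ℓ} (R : CommutativeRing c ℓ) where
  open CommutativeRing R hiding (zero)
  open Poly R
  open PolynomialRing R
  open Truncation R
  open MonicDivision R
  open CommutativeSemigroupProperties (CommutativeRing.*-commutativeSemigroup polyRing)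
    using (x∙yz≈y∙xz; xy∙z≈x∙zy)
  open AbelianGroupProperties +ₚ-abelianGroup using (xyx⁻¹≈y)

  isPFD⇒≈⌈NS⌉ : ∀ {m D′ S} → D′ *ₚ S ≈[mod-t^ m ] 1ₚ →
                ∀ N p r₁ r′ → IsPFD N (tₚ ^ₚ m) D′ p r₁ r′ → r₁ ≈ₚ ⌈t^ m ⌉ (N *ₚ S)
  isPFD⇒≈⌈NS⌉ {m} {D′} {S} D′S≈1 N p r₁ r′ (N≋ , (d , t^m-degree , r₁<d) , _) =
    ≈mod⇒≈ₚ r₁<m (⌈t^⌉-degreeBelow m (N *ₚ S)) r₁≈⌈NS⌉
    where
    open ≈mod-Reasoning m
    D₁ : Pol
    D₁ = tₚ ^ₚ m

    r₁<m : DegreeBelow m r₁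
    r₁<m = ≡.subst (λ d → DegreeBelow d r₁) (hasDegree-tₚ^ t^m-degree) r₁<d

    N≈r₁D′ : N ≈[mod-t^ m ] r₁ *ₚ D′
    N≈r₁D′ = begin
      N                                                ≈⟨ ≋⇒≈mod (coeffwise N≋) ⟩
      (p *ₚ (D₁ *ₚ D′)) +ₚ ((r₁ *ₚ D′) +ₚ (r′ *ₚ D₁))  ≈⟨ +ₚ-cong-mod (*ₚ-congˡ-mod p (*ₚ-congʳ-mod D′ (tₚ^≈0 m)))
                                                            (+ₚ-congˡ-mod (r₁ *ₚ D′) (*ₚ-congˡ-mod r′ (tₚ^≈0 m))) ⟩
      (p *ₚ []) +ₚ ((r₁ *ₚ D′) +ₚ (r′ *ₚ []))          ≈⟨ ≋⇒≈mod (+ₚ-cong (*ₚ-zeroʳ p)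
                                                            (≋-trans (+ₚ-congˡ (r₁ *ₚ D′) (*ₚ-zeroʳ r′)) (+ₚ-identityʳ _))) ⟩
      r₁ *ₚ D′                                         ∎

    r₁≈⌈NS⌉ : r₁ ≈[mod-t^ m ] ⌈t^ m ⌉ (N *ₚ S)
    r₁≈⌈NS⌉ = begin
      r₁                ≈⟨ ≋⇒≈mod (*ₚ-identityʳ r₁) ⟨
      r₁ *ₚ 1ₚ          ≈⟨ *ₚ-congˡ-mod r₁ D′S≈1 ⟨
      r₁ *ₚ (D′ *ₚ S)   ≈⟨ ≋⇒≈mod (*ₚ-assoc r₁ D′ S) ⟨
      (r₁ *ₚ D′) *ₚ S   ≈⟨ *ₚ-congʳ-mod S N≈r₁D′ ⟨
      N *ₚ S            ≈⟨ ⌈t^⌉-≈mod m (N *ₚ S) ⟨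
      ⌈t^ m ⌉ (N *ₚ S)  ∎

  ⌈NS⌉-isPFD : ¬ 1# ≈ 0# → ∀ {m d D′ S} → Monic d D′ → D′ *ₚ S ≈[mod-t^ m ] 1ₚ → ∀ N →
               ∃₂ λ p r′ → IsPFD N (tₚ ^ₚ m) D′ p (⌈t^ m ⌉ (N *ₚ S)) r′
  ⌈NS⌉-isPFD 1≉0 {m} {d} {D′} {S} D′-monic D′S≈1 N =
    quotient , remainder , ≋⇒≈ₚ N≋ ,
    (m , monic⇒hasDegree 1≉0 (monic-^ₚ tₚ-monic m) , ⌈t^⌉-degreeBelow m (N *ₚ S)) ,
    (d , monic⇒hasDegree 1≉0 D′-monic , remainder<d)
    where
    D₁ T E : Pol
    D₁ = tₚ ^ₚ m
    T  = ⌈t^ m ⌉ (N *ₚ S)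
    E  = N +ₚ (-ₚ (T *ₚ D′))

    TD′≈N : T *ₚ D′ ≈[mod-t^ m ] N
    TD′≈N = begin
      T *ₚ D′         ≈⟨ *ₚ-congʳ-mod D′ (⌈t^⌉-≈mod m (N *ₚ S)) ⟩
      (N *ₚ S) *ₚ D′  ≈⟨ ≋⇒≈mod (xy∙z≈x∙zy N S D′) ⟩
      N *ₚ (D′ *ₚ S)  ≈⟨ *ₚ-congˡ-mod N D′S≈1 ⟩
      N *ₚ 1ₚ         ≈⟨ ≋⇒≈mod (*ₚ-identityʳ N) ⟩
      N               ∎
      where open ≈mod-Reasoning m

    E≈0 : E ≈[mod-t^ m ] []
    E≈0 = begin
      N +ₚ (-ₚ (T *ₚ D′))  ≈⟨ +ₚ-congˡ-mod N (-ₚ-cong-mod TD′≈N) ⟩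
      N +ₚ (-ₚ N)          ≈⟨ ≋⇒≈mod (-ₚ-inverseʳ N) ⟩
      []                   ∎
      where open ≈mod-Reasoning m

    open Division (divMonic D′-monic (drop m E))

    N≋ : N ≋ (quotient *ₚ (D₁ *ₚ D′)) +ₚ ((T *ₚ D′) +ₚ (remainder *ₚ D₁))
    N≋ = begin
      N                                                 ≈⟨ xyx⁻¹≈y (T *ₚ D′) N ⟨
      ((T *ₚ D′) +ₚ N) +ₚ (-ₚ (T *ₚ D′))                ≈⟨ +ₚ-assoc (T *ₚ D′) N _ ⟩
      (T *ₚ D′) +ₚ E                                    ≈⟨ +ₚ-congˡ (T *ₚ D′) (≈0⇒tₚ^-factor m E E≈0) ⟩
      (T *ₚ D′) +ₚ (D₁ *ₚ drop m E)                     ≈⟨ +ₚ-congˡ (T *ₚ D′) (*ₚ-congˡ D₁ Q≋quotient*D+remainder) ⟩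
      (T *ₚ D′) +ₚ (D₁ *ₚ ((quotient *ₚ D′) +ₚ remainder))
        ≈⟨ +ₚ-congˡ (T *ₚ D′) (*ₚ-distribˡ D₁ (quotient *ₚ D′) remainder) ⟩
      (T *ₚ D′) +ₚ ((D₁ *ₚ (quotient *ₚ D′)) +ₚ (D₁ *ₚ remainder))
        ≈⟨ +ₚ-swap (T *ₚ D′) (D₁ *ₚ (quotient *ₚ D′)) (D₁ *ₚ remainder) ⟩
      (D₁ *ₚ (quotient *ₚ D′)) +ₚ ((T *ₚ D′) +ₚ (D₁ *ₚ remainder))
        ≈⟨ +ₚ-cong (x∙yz≈y∙xz D₁ quotient D′) (+ₚ-congˡ (T *ₚ D′) (*ₚ-comm D₁ remainder)) ⟩
      (quotient *ₚ (D₁ *ₚ D′)) +ₚ ((T *ₚ D′) +ₚ (remainder *ₚ D₁)) ∎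
      where open ≋-Reasoning

corollary11 : ∀ {c ℓ} (R : CommutativeRing c ℓ) → IsField R → IsAlgClosed R →
  let open CommutativeRing R
      open Poly R
  in (N : Pol) (k : ℕ) (m₀ : ℕ) (m : Fin k → ℕ) (a ainv : Fin k → Carrier) →
     1 ≤ m₀ → (∀ i → 1 ≤ m i) →
     (∀ i j → ¬ (i ≡ j) → ¬ (a i ≈ a j)) →
     (∀ i → ¬ (a i ≈ 0#)) →
     (∀ i → a i * ainv i ≈ 1#) →
     let D₁ = tₚ ^ₚ m₀
         D' = prodFinₚ k (λ i → t-ₚ (a i) ^ₚ m i)
         T  = ⌈t^ m₀ ⌉ (N *ₚ prodFinₚ k (λ i → sₚ m₀ (m i) (ainv i)))
     in (∃ λ p → ∃ λ r' → IsPFD N D₁ D' p T r')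
        × (∀ p r₁ r' → IsPFD N D₁ D' p r₁ r' → r₁ ≈ₚ T)
corollary11 R R-field _ N k m₀ m a ainv _ 1≤m _ _ a*ainv≈1 =
  ⌈NS⌉-isPFD (IsField.1≉0 R-field) (proj₂ D′-monic) D′S≈1 N , isPFD⇒≈⌈NS⌉ D′S≈1 N
  where
  open Poly R
  open PolynomialRing R
  open Truncation R
  open MonicDivision R
  open BinomialSeries R
  open PartialFractions R

  D′ S : Pol
  D′ = prodFinₚ k (λ i → t-ₚ (a i) ^ₚ m i)
  S  = prodFinₚ k (λ i → sₚ m₀ (m i) (ainv i))

  D′-monic : ∃ λ d → Monic d D′
  D′-monic = prodFinₚ-monic k _ λ i → m i , monic-^ₚ (t-ₚ-monic (a i)) (m i)

  D′S≈1 : D′ *ₚ S ≈[mod-t^ m₀ ] 1ₚ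
  D′S≈1 = prodFinₚ-inverse k _ _ λ i → [t-a]^m*sₘ≈1 (a*ainv≈1 i) m₀ (1≤m i)
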